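{- Let $1\le m\le n$. Let $0<b_1<b_2<\cdots<b_m\le n$ and $0<c_1<c_2<\cdots<c_m\le n$. (i) There exists an invertible partial endomorphism $e$ of $\mathbf{Z}_{2n}$ such that $e(b_i)=c_i$ for $1\le i\le m$. (ii) There exists an invertible partial endomorphism $e$ of $\mathbf{Z}_{2n+1}$ such that $e(b_i)=c_i$ for $1\le i\le m$ and $e(0)=0$.
   Context: $\mathbf{Z}=(\mathbb{Z};\wedge,\vee,\to,\neg)$ is the Sugihara algebra of integers: lattice operations from the natural order, $\neg a=-a$, $a\to b=(-a)\vee b$ if $a\le b$ and $(-a)\wedge b$ otherwise. $\mathbf{Z}_{2n+1}$ is the subalgebra on $\{a\mid -n\le a\le n\}$ and $\mathbf{Z}_{2n}$ the subalgebra on $\{a\mid -n\le a\le n\}\setminus\{0\}$. A partial endomorphism of an algebra $\mathbf{A}$ is a homomorphism $h:\mathrm{dom}\,h\to\mathbf{A}$ whose domain is a (non-empty) subalgebra of $\mathbf{A}$. -}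

module Defs where

open import Data.Nat as ℕ using (ℕ)
open import Data.Integer using (ℤ; +_; -_; _⊔_; _⊓_; _≤_; _≤?_; 0ℤ)
open import Data.Bool using (if_then_else_)
open import Data.Fin using (Fin)
open import Data.Product using (Σ; ∃; _×_)
open import Relation.Nullary using (¬_)
open import Relation.Nullary.Decidable using (⌊_⌋)
open import Relation.Binary.PropositionalEquality using (_≡_)

-- Sugihara operations on ℤ
_∧_ : ℤ → ℤ → ℤ
a ∧ b = a ⊓ b

_∨_ : ℤ → ℤ → ℤ
a ∨ b = a ⊔ b

¬ₛ : ℤ → ℤ
¬ₛ a = - a

_⇒_ : ℤ → ℤ → ℤ
a ⇒ b = if ⌊ a ≤? b ⌋ then (- a) ⊔ b else (- a) ⊓ b

Closed : (ℤ → Set) → Set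
Closed D = (∀ a b → D a → D b → D (a ∧ b))
         × (∀ a b → D a → D b → D (a ∨ b))
         × (∀ a b → D a → D b → D (a ⇒ b))
         × (∀ a → D a → D (¬ₛ a))

Z2n+1 : ℕ → ℤ → Set
Z2n+1 n a = (- (+ n) ≤ a) × (a ≤ + n)

Z2n : ℕ → ℤ → Set
Z2n n a = Z2n+1 n a × ¬ (a ≡ 0ℤ)

IsSubalgebra : (A D : ℤ → Set) → Set
IsSubalgebra A D = (∀ a → D a → A a) × Closed D × ∃ D

-- h (a total function ℤ → ℤ, only its values on D matter) is a
-- homomorphism from the subalgebra D of A into A
IsPartialEndo : (A D : ℤ → Set) → (ℤ → ℤ) → Set
IsPartialEndo A D h =
    IsSubalgebra A D
  × (∀ a → D a → A (h a))
  × (∀ a b → D a → D b → h (a ∧ b) ≡ h a ∧ h b)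
  × (∀ a b → D a → D b → h (a ∨ b) ≡ h a ∨ h b)
  × (∀ a b → D a → D b → h (a ⇒ b) ≡ h a ⇒ h b)
  × (∀ a → D a → h (¬ₛ a) ≡ ¬ₛ (h a))

Image : (ℤ → Set) → (ℤ → ℤ) → ℤ → Set
Image D h y = Σ ℤ (λ x → D x × (h x ≡ y))

IsInvertiblePartialEndo : (A D : ℤ → Set) → (ℤ → ℤ) → Set
IsInvertiblePartialEndo A D h =
  IsPartialEndo A D h
  × Σ (ℤ → ℤ) (λ g →
        IsPartialEndo A (Image D h) g
      × (∀ x → D x → g (h x) ≡ x)
      × (∀ y → Image D h y → h (g y) ≡ y))

InvPartialEndo : (A : ℤ → Set) → Set₁
InvPartialEndo A = Σ (ℤ → Set) (λ D → Σ (ℤ → ℤ) (λ h → IsInvertiblePartialEndo A D h))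

StrictlyIncreasing : {m : ℕ} → (Fin m → ℕ) → Set
StrictlyIncreasing {m} b = ∀ (i j : Fin m) → i Data.Fin.< j → b i ℕ.< b j

module Submission where

-- A subset D of ℤ is a chain, so on D the Sugihara operations are determined
-- by the order and negation alone: a ∧ b and a ∨ b are one of a, b, and
-- a ⇒ b is -a ∨ b or -a ∧ b according to whether a ≤ b.  Hence every map that
-- is an order embedding on a negation-closed D and commutes with negation (an
-- odd order embedding) is a partial endomorphism (partialEndo); if it has a
-- left inverse on D, that inverse is an odd order embedding on the image, so
-- the map is invertible (invertible).
--
-- Odd order embeddings arise as odd extensions z ↦ sign z · f ∣z∣ of maps
-- f : ℕ → ℕ that are order embeddings on a set X ⊆ ℕ and vanish only at 0
-- (oddExtension).  For the theorem, X is the set of values of b and f sends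
-- b i to c i; strict monotonicity of b and c makes f an order embedding
-- (finiteExtension).  Part (i) applies this to b and c, part (ii) to the
-- sequences 0 ∷ b and 0 ∷ c, which puts 0 into the domain and fixes it.

open import Defs
open import Data.Nat using (ℕ; zero; suc; _≤_; _<_; _≟_; z≤n; s≤s; s≤s⁻¹)
import Data.Nat.Properties as ℕP
open import Data.Integer as ℤ using (ℤ; +_; -_; -[1+_]; 0ℤ; ∣_∣; _⊓_; _⊔_; _≤?_; +≤+; -≤+; -≤-)
open import Data.Integer.Properties
  using (⊓-sel; ⊔-sel; i≤j⇒i⊓j≡i; i≥j⇒i⊓j≡j; i≤j⇒i⊔j≡j; i≥j⇒i⊔j≡i; ≤-total;
         drop‿+≤+; neg-involutive; neg-≤-pos; neg-mono-≤; neg-cancel-≤; ∣-i∣≡∣i∣)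
open import Data.Fin using (Fin; zero; suc; fromℕ<)
open import Data.Fin.Properties using (<-cmp; any?)
open import Data.Vec.Functional using (_∷_)
open import Data.Product using (Σ; ∃; _×_; _,_; proj₁; proj₂)
open import Data.Sum using (inj₁; inj₂)
open import Algebra.Definitions using (Selective)
open import Relation.Binary using (tri<; tri≈; tri>)
open import Relation.Binary.PropositionalEquality
  using (_≡_; refl; sym; trans; cong; subst; subst₂; module ≡-Reasoning)
open import Relation.Nullary using (¬_; yes; no; contradiction)

open ≡-Reasoning

⇒-≤ : ∀ {a b} → a ℤ.≤ b → a ⇒ b ≡ (- a) ⊔ b
⇒-≤ {a} {b} a≤b with a ≤? b
... | yes _   = refl
... | no a≰b = contradiction a≤b a≰b

⇒-≰ : ∀ {a b} → ¬ a ℤ.≤ b → a ⇒ b ≡ (- a) ⊓ b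
⇒-≰ {a} {b} a≰b with a ≤? b
... | yes a≤b = contradiction a≤b a≰b
... | no _    = refl

selective-closed : ∀ {_∙_ : ℤ → ℤ → ℤ} → Selective _≡_ _∙_
  → (D : ℤ → Set) → ∀ a b → D a → D b → D (a ∙ b)
selective-closed sel D a b Da Db with sel a b
... | inj₁ eq = subst D (sym eq) Da
... | inj₂ eq = subst D (sym eq) Db

record OddEmbedding (A D : ℤ → Set) (h : ℤ → ℤ) : Set where
  field
    inside     : ∀ a → D a → A a
    inhabited  : ∃ D
    neg-closed : ∀ a → D a → D (- a)
    maps-into  : ∀ a → D a → A (h a)
    monotone   : ∀ a b → D a → D b → a ℤ.≤ b → h a ℤ.≤ h b
    reflecting : ∀ a b → D a → D b → h a ℤ.≤ h b → a ℤ.≤ b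
    odd        : ∀ a → D a → h (- a) ≡ - h a

module _ {A D : ℤ → Set} {h : ℤ → ℤ} (E : OddEmbedding A D h) where
  open OddEmbedding E

  ⊓-preserved : ∀ a b → D a → D b → h (a ⊓ b) ≡ h a ⊓ h b
  ⊓-preserved a b Da Db with ≤-total a b
  ... | inj₁ a≤b = trans (cong h (i≤j⇒i⊓j≡i a≤b)) (sym (i≤j⇒i⊓j≡i (monotone a b Da Db a≤b)))
  ... | inj₂ b≤a = trans (cong h (i≥j⇒i⊓j≡j b≤a)) (sym (i≥j⇒i⊓j≡j (monotone b a Db Da b≤a)))

  ⊔-preserved : ∀ a b → D a → D b → h (a ⊔ b) ≡ h a ⊔ h b
  ⊔-preserved a b Da Db with ≤-total a b
  ... | inj₁ a≤b = trans (cong h (i≤j⇒i⊔j≡j a≤b)) (sym (i≤j⇒i⊔j≡j (monotone a b Da Db a≤b)))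
  ... | inj₂ b≤a = trans (cong h (i≥j⇒i⊔j≡i b≤a)) (sym (i≥j⇒i⊔j≡i (monotone b a Db Da b≤a)))

  ⇒-closed : ∀ a b → D a → D b → D (a ⇒ b)
  ⇒-closed a b Da Db with a ≤? b
  ... | yes _ = selective-closed ⊔-sel D (- a) b (neg-closed a Da) Db
  ... | no _  = selective-closed ⊓-sel D (- a) b (neg-closed a Da) Db

  -- since h preserves and reflects a ≤ b, both sides of a ⇒ b take the same branch
  ⇒-preserved : ∀ a b → D a → D b → h (a ⇒ b) ≡ h a ⇒ h b
  ⇒-preserved a b Da Db with a ≤? b
  ... | yes a≤b = begin
    h ((- a) ⊔ b)   ≡⟨ ⊔-preserved (- a) b (neg-closed a Da) Db ⟩
    h (- a) ⊔ h b   ≡⟨ cong (_⊔ h b) (odd a Da) ⟩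
    (- h a) ⊔ h b   ≡⟨ sym (⇒-≤ (monotone a b Da Db a≤b)) ⟩
    h a ⇒ h b       ∎
  ... | no a≰b = begin
    h ((- a) ⊓ b)   ≡⟨ ⊓-preserved (- a) b (neg-closed a Da) Db ⟩
    h (- a) ⊓ h b   ≡⟨ cong (_⊓ h b) (odd a Da) ⟩
    (- h a) ⊓ h b   ≡⟨ sym (⇒-≰ (λ ha≤hb → a≰b (reflecting a b Da Db ha≤hb))) ⟩
    h a ⇒ h b       ∎

  partialEndo : IsPartialEndo A D h
  partialEndo =
      (inside , (selective-closed ⊓-sel D , selective-closed ⊔-sel D , ⇒-closed , neg-closed) , inhabited)
    , maps-into , ⊓-preserved , ⊔-preserved , ⇒-preserved , odd

  inverse : (g : ℤ → ℤ) → (∀ a → D a → g (h a) ≡ a) → OddEmbedding A (Image D h) g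
  inverse g left = record
    { inside     = λ { _ (a , Da , refl) → maps-into a Da }
    ; inhabited  = h (proj₁ inhabited) , proj₁ inhabited , proj₂ inhabited , refl
    ; neg-closed = λ { _ (a , Da , refl) → - a , neg-closed a Da , odd a Da }
    ; maps-into  = λ { _ (a , Da , refl) → subst A (sym (left a Da)) (inside a Da) }
    ; monotone   = λ { _ _ (a , Da , refl) (b , Db , refl) ha≤hb →
        subst₂ ℤ._≤_ (sym (left a Da)) (sym (left b Db)) (reflecting a b Da Db ha≤hb) }
    ; reflecting = λ { _ _ (a , Da , refl) (b , Db , refl) gha≤ghb →
        monotone a b Da Db (subst₂ ℤ._≤_ (left a Da) (left b Db) gha≤ghb) }
    ; odd        = λ { _ (a , Da , refl) → begin
        g (- h a)   ≡⟨ cong g (sym (odd a Da)) ⟩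
        g (h (- a)) ≡⟨ left (- a) (neg-closed a Da) ⟩
        - a         ≡⟨ cong -_ (sym (left a Da)) ⟩
        - g (h a)   ∎ }
    }

invertible : ∀ {A D h} → OddEmbedding A D h
  → (g : ℤ → ℤ) → (∀ a → D a → g (h a) ≡ a) → IsInvertiblePartialEndo A D h
invertible {D = D} {h} E g left = partialEndo E , g , partialEndo (inverse E g left) , left , right
  where
  right : ∀ y → Image D h y → h (g y) ≡ y
  right _ (a , Da , refl) = cong h (left a Da)

-- the odd extension z ↦ sign z · f ∣z∣ of a map f on ℕ
ext : (ℕ → ℕ) → ℤ → ℤ
ext f (+ k)    = + f k
ext f -[1+ k ] = - + f (suc k)

ext-neg : ∀ {f} → f 0 ≡ 0 → ∀ k → ext f (- + k) ≡ - + f k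
ext-neg f0 zero    = trans (cong +_ f0) (cong (λ k → - + k) (sym f0))
ext-neg f0 (suc k) = refl

∣ext∣ : ∀ f z → ∣ ext f z ∣ ≡ f ∣ z ∣
∣ext∣ f (+ k)    = refl
∣ext∣ f -[1+ k ] = ∣-i∣≡∣i∣ (+ f (suc k))

Sym : (ℕ → Set) → ℤ → Set
Sym X z = X ∣ z ∣

record NatEmbedding (X : ℕ → Set) (f : ℕ → ℕ) : Set where
  field
    fixes-zero : f 0 ≡ 0
    only-zero  : ∀ x → X x → f x ≡ 0 → x ≡ 0
    monotone   : ∀ x y → X x → X y → x ≤ y → f x ≤ f y
    reflecting : ∀ x y → X x → X y → f x ≤ f y → x ≤ y

pos≤neg⇒0 : ∀ {m n} → + m ℤ.≤ - + n → n ≡ 0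
pos≤neg⇒0 {n = zero} _ = refl

oddExtension : ∀ {X f} (A : ℤ → Set) (P : ℕ → Set) → (∀ z → P ∣ z ∣ → A z)
  → NatEmbedding X f → ∃ X → (∀ x → X x → P x) → (∀ x → X x → P (f x))
  → OddEmbedding A (Sym X) (ext f)
oddExtension {X} {f} A P carrier F (x₀ , Xx₀) X⊆P fX⊆P = record
  { inside     = λ z Xz → carrier z (X⊆P ∣ z ∣ Xz)
  ; inhabited  = + x₀ , Xx₀
  ; neg-closed = λ z Xz → subst X (sym (∣-i∣≡∣i∣ z)) Xz
  ; maps-into  = λ z Xz → carrier (ext f z) (subst P (sym (∣ext∣ f z)) (fX⊆P ∣ z ∣ Xz))
  ; monotone   = ext-monotone
  ; reflecting = ext-reflecting
  ; odd        = ext-odd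
  }
  where
  open NatEmbedding F

  ext-monotone : ∀ a b → Sym X a → Sym X b → a ℤ.≤ b → ext f a ℤ.≤ ext f b
  ext-monotone (+ p)    (+ q)    Xp Xq (+≤+ p≤q) = +≤+ (monotone p q Xp Xq p≤q)
  ext-monotone -[1+ p ] (+ q)    _  _  _         = neg-≤-pos
  ext-monotone -[1+ p ] -[1+ q ] Xp Xq (-≤- q≤p) =
    neg-mono-≤ (+≤+ (monotone (suc q) (suc p) Xq Xp (s≤s q≤p)))

  ext-reflecting : ∀ a b → Sym X a → Sym X b → ext f a ℤ.≤ ext f b → a ℤ.≤ b
  ext-reflecting (+ p)    (+ q)    Xp Xq le = +≤+ (reflecting p q Xp Xq (drop‿+≤+ le))
  ext-reflecting (+ p)    -[1+ q ] Xp Xq le with () ← only-zero (suc q) Xq (pos≤neg⇒0 le)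
  ext-reflecting -[1+ p ] (+ q)    _  _  _  = -≤+
  ext-reflecting -[1+ p ] -[1+ q ] Xp Xq le =
    -≤- (s≤s⁻¹ (reflecting (suc q) (suc p) Xq Xp (drop‿+≤+ (neg-cancel-≤ le))))

  ext-odd : ∀ a → Sym X a → ext f (- a) ≡ - ext f a
  ext-odd (+ k)    _ = ext-neg fixes-zero k
  ext-odd -[1+ k ] _ = sym (neg-involutive (+ f (suc k)))

ext-leftInverse : ∀ {X f g} → g 0 ≡ 0 → (∀ x → X x → g (f x) ≡ x)
  → ∀ z → Sym X z → ext g (ext f z) ≡ z
ext-leftInverse g0 left (+ k)    Xk = cong +_ (left k Xk)
ext-leftInverse {f = f} {g} g0 left -[1+ k ] Xk = begin
  ext g (- + f (suc k)) ≡⟨ ext-neg g0 (f (suc k)) ⟩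
  - + g (f (suc k))     ≡⟨ cong (λ x → - + x) (left (suc k) Xk) ⟩
  -[1+ k ]              ∎

module _ {m : ℕ} where

  increasing-injective : {b : Fin m → ℕ} → StrictlyIncreasing b → ∀ i j → b i ≡ b j → i ≡ j
  increasing-injective b↑ i j bi≡bj with <-cmp i j
  ... | tri< i<j _ _ = contradiction bi≡bj (ℕP.<⇒≢ (b↑ i j i<j))
  ... | tri≈ _ i≡j _ = i≡j
  ... | tri> _ _ j<i = contradiction bi≡bj (ℕP.>⇒≢ (b↑ j i j<i))

  increasing-transfer : {b c : Fin m → ℕ} → StrictlyIncreasing b → StrictlyIncreasing c
    → ∀ i j → b i ≤ b j → c i ≤ c j
  increasing-transfer b↑ c↑ i j bi≤bj with <-cmp i j
  ... | tri< i<j _ _  = ℕP.<⇒≤ (c↑ i j i<j)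
  ... | tri≈ _ refl _ = ℕP.≤-refl
  ... | tri> _ _ j<i  = contradiction bi≤bj (ℕP.<⇒≱ (b↑ j i j<i))

  Values : (Fin m → ℕ) → ℕ → Set
  Values b k = ∃ λ i → b i ≡ k

  -- the map sending b i to c i and everything outside the values of b to 0
  assignment : (Fin m → ℕ) → (Fin m → ℕ) → ℕ → ℕ
  assignment b c k with any? (λ i → b i ≟ k)
  ... | yes (i , _) = c i
  ... | no _        = 0

  assignment-at : {b : Fin m → ℕ} (c : Fin m → ℕ) → (∀ i j → b i ≡ b j → i ≡ j)
    → ∀ i → assignment b c (b i) ≡ c i
  assignment-at {b} c b-inj i with any? (λ j → b j ≟ b i)
  ... | yes (j , bj≡bi) = cong c (b-inj j i bj≡bi)
  ... | no none         = contradiction (i , refl) none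

  ZerosMatch : (Fin m → ℕ) → (Fin m → ℕ) → Set
  ZerosMatch b c = ∀ i → b i ≡ 0 → c i ≡ 0

  assignment-zero : {b c : Fin m → ℕ} → ZerosMatch b c → assignment b c 0 ≡ 0
  assignment-zero {b} zeros with any? (λ j → b j ≟ 0)
  ... | yes (j , bj≡0) = zeros j bj≡0
  ... | no _           = refl

  assignment-embedding : {b c : Fin m → ℕ} → StrictlyIncreasing b → StrictlyIncreasing c
    → ZerosMatch b c → ZerosMatch c b → NatEmbedding (Values b) (assignment b c)
  assignment-embedding {b} {c} b↑ c↑ zeros-bc zeros-cb = record
    { fixes-zero = assignment-zero zeros-bc
    ; only-zero  = λ { _ (i , refl) fbi≡0 → zeros-cb i (trans (sym (at i)) fbi≡0) }
    ; monotone   = λ { _ _ (i , refl) (j , refl) bi≤bj →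
        subst₂ _≤_ (sym (at i)) (sym (at j)) (increasing-transfer b↑ c↑ i j bi≤bj) }
    ; reflecting = λ { _ _ (i , refl) (j , refl) fbi≤fbj →
        increasing-transfer c↑ b↑ i j (subst₂ _≤_ (at i) (at j) fbi≤fbj) }
    }
    where
    at : ∀ i → assignment b c (b i) ≡ c i
    at = assignment-at c (increasing-injective b↑)

  Extension : (A : ℤ → Set) → (Fin m → ℕ) → (Fin m → ℕ) → Set₁
  Extension A b c = Σ (ℤ → Set) λ D → Σ (ℤ → ℤ) λ e →
    IsInvertiblePartialEndo A D e × (∀ i → D (+ b i) × (e (+ b i) ≡ + c i))

  finiteExtension : (A : ℤ → Set) (P : ℕ → Set) → (∀ z → P ∣ z ∣ → A z)
    → Fin m → (b c : Fin m → ℕ) → StrictlyIncreasing b → StrictlyIncreasing c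
    → ZerosMatch b c → ZerosMatch c b → (∀ i → P (b i)) → (∀ i → P (c i))
    → Extension A b c
  finiteExtension A P carrier i₀ b c b↑ c↑ zeros-bc zeros-cb Pb Pc =
      Sym (Values b) , ext (assignment b c)
    , invertible embedding (ext (assignment c b)) inverse-on-domain
    , λ i → (i , refl) , cong +_ (sends i)
    where
    sends : ∀ i → assignment b c (b i) ≡ c i
    sends = assignment-at c (increasing-injective b↑)

    embedding : OddEmbedding A (Sym (Values b)) (ext (assignment b c))
    embedding = oddExtension A P carrier (assignment-embedding b↑ c↑ zeros-bc zeros-cb)
      (b i₀ , i₀ , refl) (λ { _ (i , refl) → Pb i })
      (λ { _ (i , refl) → subst P (sym (sends i)) (Pc i) })

    inverse-on-domain : ∀ z → Sym (Values b) z → ext (assignment c b) (ext (assignment b c) z) ≡ z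
    inverse-on-domain = ext-leftInverse {X = Values b} (assignment-zero zeros-cb) λ
      { _ (i , refl) → trans (cong (assignment c b) (sends i))
                             (assignment-at b (increasing-injective c↑) i) }

cons-zero-increasing : ∀ {m} {b : Fin m → ℕ} → (∀ i → 0 < b i) → StrictlyIncreasing b
  → StrictlyIncreasing (0 ∷ b)
cons-zero-increasing pos b↑ zero    (suc j) _         = pos j
cons-zero-increasing pos b↑ (suc i) (suc j) (s≤s i<j) = b↑ i j i<j

positive-zeros : ∀ {m} {b : Fin m → ℕ} (c : Fin m → ℕ) → (∀ i → 0 < b i) → ZerosMatch b c
positive-zeros c pos i bi≡0 = contradiction bi≡0 (ℕP.>⇒≢ (pos i))

cons-zero-zeros : ∀ {m} {b : Fin m → ℕ} (c : Fin m → ℕ) → (∀ i → 0 < b i) → ZerosMatch (0 ∷ b) (0 ∷ c)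
cons-zero-zeros c pos zero    _ = refl
cons-zero-zeros c pos (suc i)   = positive-zeros c pos i

cons-zero-extension : ∀ {m} {A : ℤ → Set} {b c : Fin m → ℕ} → Extension A (0 ∷ b) (0 ∷ c)
  → Σ (ℤ → Set) λ D → Σ (ℤ → ℤ) λ e → IsInvertiblePartialEndo A D e
      × (∀ i → D (+ b i) × (e (+ b i) ≡ + c i)) × D 0ℤ × (e 0ℤ ≡ 0ℤ)
cons-zero-extension (D , e , e-invertible , sends) =
  D , e , e-invertible , (λ i → sends (suc i)) , sends zero

bounded-in-Z2n+1 : ∀ n z → ∣ z ∣ ≤ n → Z2n+1 n z
bounded-in-Z2n+1 n (+ k)    k≤n = neg-≤-pos , +≤+ k≤n
bounded-in-Z2n+1 n -[1+ k ] k<n = neg-mono-≤ (+≤+ k<n) , -≤+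

bounded-in-Z2n : ∀ n z → (0 < ∣ z ∣) × (∣ z ∣ ≤ n) → Z2n n z
bounded-in-Z2n n z (pos , bounded) = bounded-in-Z2n+1 n z bounded , λ { refl → ℕP.<-irrefl refl pos }

corollary2p6 : (m n : ℕ) → 1 ≤ m → m ≤ n → (b c : Fin m → ℕ)
    → StrictlyIncreasing b → (∀ i → (0 < b i) × (b i ≤ n))
    → StrictlyIncreasing c → (∀ i → (0 < c i) × (c i ≤ n))
    → Σ (ℤ → Set) (λ D → Σ (ℤ → ℤ) (λ e →
          IsInvertiblePartialEndo (Z2n n) D e
        × (∀ i → D (+ b i) × (e (+ b i) ≡ + c i))))
    × Σ (ℤ → Set) (λ D → Σ (ℤ → ℤ) (λ e →
          IsInvertiblePartialEndo (Z2n+1 n) D e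
        × (∀ i → D (+ b i) × (e (+ b i) ≡ + c i))
        × D 0ℤ × (e 0ℤ ≡ 0ℤ)))
corollary2p6 m n 1≤m _ b c b↑ b-range c↑ c-range = part-i , cons-zero-extension part-ii
  where
  b-pos : ∀ i → 0 < b i
  b-pos i = proj₁ (b-range i)
  c-pos : ∀ i → 0 < c i
  c-pos i = proj₁ (c-range i)

  part-i : Extension (Z2n n) b c
  part-i = finiteExtension (Z2n n) (λ k → (0 < k) × (k ≤ n)) (bounded-in-Z2n n) (fromℕ< 1≤m)
    b c b↑ c↑ (positive-zeros c b-pos) (positive-zeros b c-pos) b-range c-range

  bounded-cons : ∀ {x : Fin m → ℕ} → (∀ i → (0 < x i) × (x i ≤ n)) → ∀ i → (0 ∷ x) i ≤ n
  bounded-cons x-range zero    = z≤n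
  bounded-cons x-range (suc i) = proj₂ (x-range i)

  part-ii : Extension (Z2n+1 n) (0 ∷ b) (0 ∷ c)
  part-ii = finiteExtension (Z2n+1 n) (_≤ n) (bounded-in-Z2n+1 n) zero
    (0 ∷ b) (0 ∷ c) (cons-zero-increasing b-pos b↑) (cons-zero-increasing c-pos c↑)
    (cons-zero-zeros c b-pos) (cons-zero-zeros b c-pos) (bounded-cons b-range) (bounded-cons c-range)
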